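{- For every graph $G$ and every weakly submodular and tame annotated graph parameter $\lambda$, we have $\lambda\text{ - }\mathrm{td}(G)\le\lambda\text{ - }\mathrm{vc}(G)+1$.
   Context: All graphs are finite, simple and undirected. An annotated graph parameter is a function $\lambda$ assigning an integer $\lambda(G,X)$ to each graph $G$ and $X\subseteq V(G)$, invariant under isomorphisms. It is weakly submodular if for every graph $G$ and every finite collection $(X_i)_{i\in I}$ of subsets of $V(G)$, $\lambda(G,\bigcup_{i\in I}X_i)\le\sum_{i\in I}\lambda(G,X_i)$, and tame if $\lambda(G,\{v\})\le1$ for every graph $G$ and $v\in V(G)$. $\lambda\text{ - }\mathrm{vc}(G)$ is the minimum of $\lambda(G,X)$ over all vertex covers $X$ of $G$ (sets meeting every edge). A treedepth decomposition of $G$ is a rooted forest $F$ (disjoint union of rooted trees) with vertex set $V(G)$ such that $G$ is a subgraph of the graph obtained from $F$ by making each root-to-leaf path a clique; $\lambda\text{ - }\mathrm{td}(G)$ is the minimum, over treedepth decompositions $F$ of $G$, of the maximum of $\lambda(G,V(Q))$ over root-to-leaf paths $Q$ of $F$. -}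

module Defs where

open import Data.Bool using (Bool; true; false)
open import Data.Nat using (ℕ)
open import Data.Fin using (Fin)
open import Data.Fin.Subset using (Subset; _∈_; ⁅_⁆; ⋃)
open import Data.Integer using (ℤ; _+_; _≤_; 0ℤ; 1ℤ)
open import Data.List using (List; foldr; map)
open import Data.Maybe using (Maybe; just; nothing)
open import Data.Sum using (_⊎_)
open import Data.Product using (Σ; _×_)
open import Function.Bundles using (_⤖_; Bijection; _⇔_)
open import Relation.Binary.PropositionalEquality using (_≡_; _≢_)
open import Relation.Nullary using (¬_)

record Graph (n : ℕ) : Set where
  field
    adj    : Fin n → Fin n → Bool
    sym    : ∀ u v → adj u v ≡ adj v u
    irrefl : ∀ v → adj v v ≡ false
open Graph public

AnnotatedParam : Set
AnnotatedParam = ∀ {n} → Graph n → Subset n → ℤ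

IsIso : ∀ {n m} → Graph n → Graph m → (Fin n ⤖ Fin m) → Set
IsIso G H f = ∀ u v → adj G u v ≡ adj H (Bijection.to f u) (Bijection.to f v)

IsoInvariant : AnnotatedParam → Set
IsoInvariant λp = ∀ {n m} (G : Graph n) (H : Graph m) (f : Fin n ⤖ Fin m) →
  IsIso G H f → (X : Subset n) (Y : Subset m) →
  (∀ u → (u ∈ X) ⇔ (Bijection.to f u ∈ Y)) → λp G X ≡ λp H Y

sumℤ : List ℤ → ℤ
sumℤ = foldr _+_ 0ℤ

WeaklySubmodular : AnnotatedParam → Set
WeaklySubmodular λp = ∀ {n} (G : Graph n) (Xs : List (Subset n)) →
  λp G (⋃ Xs) ≤ sumℤ (map (λp G) Xs)

Tame : AnnotatedParam → Set
Tame λp = ∀ {n} (G : Graph n) (v : Fin n) → λp G ⁅ v ⁆ ≤ 1ℤ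

IsVertexCover : ∀ {n} → Graph n → Subset n → Set
IsVertexCover G X = ∀ u v → adj G u v ≡ true → (u ∈ X) ⊎ (v ∈ X)

-- Rooted forests on Fin n, given by a parent map (nothing = root).
Parent : ℕ → Set
Parent n = Fin n → Maybe (Fin n)

-- Anc p u v : u is an ancestor of v (reflexive).
data Anc {n} (p : Parent n) : Fin n → Fin n → Set where
  anc-refl : ∀ {v} → Anc p v v
  anc-step : ∀ {u v w} → p v ≡ just w → Anc p u w → Anc p u v

IsForest : ∀ {n} → Parent n → Set
IsForest p = ∀ v w → p v ≡ just w → ¬ Anc p v w

IsLeaf : ∀ {n} → Parent n → Fin n → Set
IsLeaf p ℓ = ∀ v → p v ≢ just ℓ

-- G is a subgraph of the closure of F: every edge joins two vertices
-- lying on a common root-to-leaf path, i.e. comparable in the ancestor order.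
IsTDDecomposition : ∀ {n} → Graph n → Parent n → Set
IsTDDecomposition G p = IsForest p ×
  (∀ u v → adj G u v ≡ true → Anc p u v ⊎ Anc p v u)

IsRootLeafPathSet : ∀ {n} → Parent n → Subset n → Set
IsRootLeafPathSet p Q = Σ _ λ ℓ → IsLeaf p ℓ × (∀ u → (u ∈ Q) ⇔ Anc p u ℓ)

TdAtMost : AnnotatedParam → ∀ {n} → Graph n → ℤ → Set
TdAtMost λp {n} G k = Σ (Parent n) λ p → IsTDDecomposition G p ×
  (∀ Q → IsRootLeafPathSet p Q → λp G Q ≤ k)

module Submission where

open import Defs
open import Data.Nat using (ℕ)
open import Data.Fin.Subset using (Subset)
open import Data.Integer using (_+_; 1ℤ)

open import Data.Nat using (zero; suc; _<_; _≤_; _<?_; s≤s)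
open import Data.Nat.Properties
  using (≤-refl; ≤-trans; <-trans; <-irrefl; <-asym; <⇒≤; ≤-pred; m≤n⇒m≤1+n; ≤-reflexive; m≤n⇒m<n∨m≡n; <-cmp)
import Data.Integer as ℤ
import Data.Integer.Properties as ℤ
open import Data.Bool using (true)
open import Data.Fin using (Fin; toℕ; fromℕ<)
open import Data.Fin.Properties using (toℕ-injective; toℕ-fromℕ<; toℕ<n)
open import Data.Fin.Subset using (_∈_; _∪_; _⊆_; ⁅_⁆)
open import Data.Fin.Subset.Properties using (_∈?_; ⊆-antisym; ∪-identityʳ; x∈p∪q⁻; x∈p∪q⁺; x∈⁅y⁆⇒x≡y; x∈⁅x⁆)
open import Data.List using (_∷_; [])
open import Data.Maybe using (Maybe; just; nothing)
open import Data.Sum using (_⊎_; inj₁; inj₂; swap)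
open import Data.Product using (_×_; _,_; proj₁; proj₂; ∃-syntax)
open import Function.Bundles using (Equivalence; _⇔_)
open import Relation.Binary using (tri<; tri≈; tri>)
open import Relation.Binary.PropositionalEquality using (_≡_; refl; trans; cong; subst; subst₂) renaming (sym to ≡-sym)
open import Relation.Nullary using (yes; no; contradiction)

-- Put the cover X on a single path, ordered by index, and hang every
-- vertex outside X as a leaf below the last vertex of X.  Since X is a
-- vertex cover, every edge has an endpoint on the path and is therefore
-- comparable in the ancestor order.  The root-to-leaf path ending at ℓ
-- is X ∪ {ℓ}, so weak submodularity and tameness bound its value by
-- λ(G,X) + 1.

Anc-leaf : ∀ {n} {p : Parent n} {ℓ v} → IsLeaf p ℓ → Anc p ℓ v → ℓ ≡ v
Anc-leaf leaf anc-refl = refl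
Anc-leaf leaf (anc-step pv≡w ℓ≤w) with refl ← Anc-leaf leaf ℓ≤w = contradiction pv≡w (leaf _)

module _ (λp : AnnotatedParam) (submodular : WeaklySubmodular λp) {n} (G : Graph n) where

  ∪-subadditive : ∀ X Y → λp G (X ∪ Y) ℤ.≤ λp G X + λp G Y
  ∪-subadditive X Y =
    subst₂ ℤ._≤_ (cong (λ Z → λp G (X ∪ Z)) (∪-identityʳ Y)) (cong (λp G X +_) (ℤ.+-identityʳ _))
      (submodular G (X ∷ Y ∷ []))

  ∪-singleton-≤ : Tame λp → ∀ X v → λp G (X ∪ ⁅ v ⁆) ℤ.≤ λp G X + 1ℤ
  ∪-singleton-≤ tame X v = ℤ.≤-trans (∪-subadditive X ⁅ v ⁆) (ℤ.+-monoʳ-≤ (λp G X) (tame G v))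

module SpineForest {n} (X : Subset n) where

  memberAt : ℕ → Maybe (Fin n)
  memberAt k with k <? n
  ... | no _ = nothing
  ... | yes k<n with fromℕ< k<n ∈? X
  ...   | yes _ = just (fromℕ< k<n)
  ...   | no _  = nothing

  memberAt-sound : ∀ k {w} → memberAt k ≡ just w → w ∈ X × toℕ w ≡ k
  memberAt-sound k eq with k <? n
  ... | yes k<n with fromℕ< k<n ∈? X
  memberAt-sound k refl | yes k<n | yes k∈X = k∈X , toℕ-fromℕ< k<n

  memberAt-complete : ∀ {x} → x ∈ X → memberAt (toℕ x) ≡ just x
  memberAt-complete {x} x∈X with toℕ x <? n
  ... | no x≮n = contradiction (toℕ<n x) x≮n
  ... | yes x<n with fromℕ< x<n ∈? X
  ...   | yes _ = cong just (toℕ-injective (toℕ-fromℕ< x<n))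
  ...   | no x∉X = contradiction (subst (_∈ X) (≡-sym (toℕ-injective (toℕ-fromℕ< x<n))) x∈X) x∉X

  lastBelow : ℕ → Maybe (Fin n)
  lastBelow zero = nothing
  lastBelow (suc k) with memberAt k
  ... | just w  = just w
  ... | nothing = lastBelow k

  lastBelow-sound : ∀ k {w} → lastBelow k ≡ just w → w ∈ X × toℕ w < k
  lastBelow-sound (suc k) eq with memberAt k in e
  lastBelow-sound (suc k) refl | just w = let w∈X , w≡k = memberAt-sound k e in w∈X , s≤s (≤-reflexive w≡k)
  ... | nothing = let w∈X , w<k = lastBelow-sound k eq in w∈X , m≤n⇒m≤1+n w<k

  lastBelow-maximal : ∀ k {x} → x ∈ X → toℕ x < k → ∃[ w ] lastBelow k ≡ just w × toℕ x ≤ toℕ w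
  lastBelow-maximal (suc k) x∈X (s≤s x≤k) with memberAt k in e
  ... | just w = w , refl , ≤-trans x≤k (≤-reflexive (≡-sym (proj₂ (memberAt-sound k e))))
  ... | nothing with m≤n⇒m<n∨m≡n x≤k
  ...   | inj₁ x<k = lastBelow-maximal k x∈X x<k
  ...   | inj₂ refl = contradiction (trans (≡-sym e) (memberAt-complete x∈X)) λ ()

  -- Outside X the height is n, so those vertices hang below the last vertex of X.
  height : Fin n → ℕ
  height v with v ∈? X
  ... | yes _ = toℕ v
  ... | no _  = n

  height-∈ : ∀ {v} → v ∈ X → height v ≡ toℕ v
  height-∈ {v} v∈X with v ∈? X
  ... | yes _   = refl
  ... | no v∉X = contradiction v∈X v∉X

  height-∈-< : ∀ {v} → v ∈ X → height v < n
  height-∈-< {v} v∈X = subst (_< n) (≡-sym (height-∈ v∈X)) (toℕ<n v)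

  height-≤ : ∀ v → height v ≤ n
  height-≤ v with v ∈? X
  ... | yes _ = <⇒≤ (toℕ<n v)
  ... | no _  = ≤-refl

  height-<⇒∈ : ∀ {v} → height v < n → v ∈ X
  height-<⇒∈ {v} v<n with v ∈? X
  ... | yes v∈X = v∈X
  ... | no _    = contradiction v<n (<-irrefl refl)

  height-injective : ∀ {u v} → u ∈ X → v ∈ X → height u ≡ height v → u ≡ v
  height-injective u∈X v∈X u≡v = toℕ-injective (trans (≡-sym (height-∈ u∈X)) (trans u≡v (height-∈ v∈X)))

  parent : Parent n
  parent v = lastBelow (height v)

  parent-sound : ∀ v {w} → parent v ≡ just w → w ∈ X × height w < height v
  parent-sound v pv≡w with lastBelow-sound (height v) pv≡w
  ... | w∈X , w<v = w∈X , subst (_< height v) (≡-sym (height-∈ w∈X)) w<v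

  parent-maximal : ∀ {u} v → u ∈ X → height u < height v → ∃[ w ] parent v ≡ just w × height u ≤ height w
  parent-maximal {u} v u∈X u<v with lastBelow-maximal (height v) u∈X (subst (_< height v) (height-∈ u∈X) u<v)
  ... | w , pv≡w , u≤w =
    w , pv≡w , subst₂ _≤_ (≡-sym (height-∈ u∈X)) (≡-sym (height-∈ (proj₁ (lastBelow-sound (height v) pv≡w)))) u≤w

  Anc⇒≡⊎below : ∀ {u v} → Anc parent u v → u ≡ v ⊎ (u ∈ X × height u < height v)
  Anc⇒≡⊎below anc-refl = inj₁ refl
  Anc⇒≡⊎below (anc-step {v = v} pv≡w u≤w) with parent-sound v pv≡w | Anc⇒≡⊎below u≤w
  ... | w∈X , w<v | inj₁ refl         = inj₂ (w∈X , w<v)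
  ... | _   , w<v | inj₂ (u∈X , u<w) = inj₂ (u∈X , <-trans u<w w<v)

  -- m is fuel bounding height v; each parent step lowers the height.
  below⇒Anc : ∀ m {u v} → u ∈ X → height u < height v → height v ≤ m → Anc parent u v
  below⇒Anc zero u∈X u<v v≤0 = contradiction (≤-trans u<v v≤0) λ ()
  below⇒Anc (suc m) {u} {v} u∈X u<v v≤m with parent-maximal v u∈X u<v
  ... | w , pv≡w , u≤w with parent-sound v pv≡w | m≤n⇒m<n∨m≡n u≤w
  ...   | _   , w<v | inj₁ u<w = anc-step pv≡w (below⇒Anc m u∈X u<w (≤-pred (≤-trans w<v v≤m)))
  ...   | w∈X , _   | inj₂ u≡w = anc-step pv≡w (subst (Anc parent u) (height-injective u∈X w∈X u≡w) anc-refl)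

  isForest : IsForest parent
  isForest v w pv≡w v≤w with parent-sound v pv≡w | Anc⇒≡⊎below v≤w
  ... | _ , w<v | inj₁ refl      = <-irrefl refl w<v
  ... | _ , w<v | inj₂ (_ , v<w) = <-asym v<w w<v

  ∈⇒comparable : ∀ {u} v → u ∈ X → Anc parent u v ⊎ Anc parent v u
  ∈⇒comparable {u} v u∈X with <-cmp (height u) (height v)
  ... | tri< u<v _ _ = inj₁ (below⇒Anc n u∈X u<v (height-≤ v))
  ... | tri≈ _ u≡v _ = inj₁ (subst (Anc parent u) (height-injective u∈X v∈X u≡v) anc-refl)
    where v∈X = height-<⇒∈ (subst (_< n) u≡v (height-∈-< u∈X))
  ... | tri> _ _ v<u = inj₂ (below⇒Anc n (height-<⇒∈ (<-trans v<u (height-∈-< u∈X))) v<u (height-≤ u))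

  vertexCover⇒decomposition : ∀ (G : Graph n) → IsVertexCover G X → IsTDDecomposition G parent
  vertexCover⇒decomposition G cover = isForest , comparable
    where
    comparable : ∀ u v → adj G u v ≡ true → Anc parent u v ⊎ Anc parent v u
    comparable u v uv with cover u v uv
    ... | inj₁ u∈X = ∈⇒comparable v u∈X
    ... | inj₂ v∈X = swap (∈⇒comparable u v∈X)

  rootLeafPath≡ : ∀ {Q ℓ} → IsLeaf parent ℓ → (∀ u → (u ∈ Q) ⇔ Anc parent u ℓ) → Q ≡ X ∪ ⁅ ℓ ⁆
  rootLeafPath≡ {Q} {ℓ} leaf Q⇔ = ⊆-antisym Q⊆ ⊆Q
    where
    Q⊆ : Q ⊆ X ∪ ⁅ ℓ ⁆
    Q⊆ {u} u∈Q with Anc⇒≡⊎below (Equivalence.to (Q⇔ u) u∈Q)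
    ... | inj₁ refl     = x∈p∪q⁺ (inj₂ (x∈⁅x⁆ ℓ))
    ... | inj₂ (u∈X , _) = x∈p∪q⁺ (inj₁ u∈X)
    onPath : ∀ {u} → u ∈ X ⊎ u ∈ ⁅ ℓ ⁆ → Anc parent u ℓ
    onPath (inj₁ u∈X) with ∈⇒comparable ℓ u∈X
    ... | inj₁ u≤ℓ = u≤ℓ
    ... | inj₂ ℓ≤u with refl ← Anc-leaf leaf ℓ≤u = anc-refl
    onPath (inj₂ u∈ℓ) with refl ← x∈⁅y⁆⇒x≡y ℓ u∈ℓ = anc-refl
    ⊆Q : X ∪ ⁅ ℓ ⁆ ⊆ Q
    ⊆Q {u} u∈ = Equivalence.from (Q⇔ u) (onPath (x∈p∪q⁻ X ⁅ ℓ ⁆ u∈))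

proposition6p7 : (λp : AnnotatedParam) → IsoInvariant λp → WeaklySubmodular λp → Tame λp →
    ∀ {n} (G : Graph n) (X : Subset n) → IsVertexCover G X →
    TdAtMost λp G (λp G X + 1ℤ)
proposition6p7 λp _ submodular tame G X cover =
  parent , vertexCover⇒decomposition G cover , pathBound
  where
  open SpineForest X
  pathBound : ∀ Q → IsRootLeafPathSet parent Q → λp G Q ℤ.≤ λp G X + 1ℤ
  pathBound Q (ℓ , leaf , Q⇔) rewrite rootLeafPath≡ leaf Q⇔ = ∪-singleton-≤ λp submodular G tame X ℓ
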